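{- A positive sequent $\Gamma\to\Delta$ without extension variables is provable in $\mathsf{posELNDT}$ if and only if $\bigwedge\Gamma\supset\bigvee\Delta$ is valid (true under every assignment).
   Context: eNDT formulas: built from propositional variables, constants $0,1$ and extension variables by $\vee$ and decisions $\mathrm{dec}(A,p,B)$ ("if $p$ then $B$ else $A$", $p$ a propositional variable), with the standard semantics under assignments ($\mathrm{dec}(A,p,B)$ true iff ($p$ false and $A$ true) or ($p$ true and $B$ true)); an extension variable $e$ defined by axiom $e\leftrightarrow A$ is interpreted as $A$. $\mathrm{pd}(A,p,C):=\mathrm{dec}(A,p,A\vee C)$; a formula is positive if all its decisions have this form; a sequent is positive if all its formulas are. Extension axioms: $\{e_i\leftrightarrow A_i\}_{i<n}$ with $A_i$ using only $e_0,\dots,e_{i-1}$; $e\leftrightarrow A$ stands for sequents $e\to A$ and $A\to e$. $\mathsf{posELNDT}$: initial sequents $0\to$, $\to1$, $p\to p$; cut (from $\Gamma\to\Delta,A$ and $\Gamma,A\to\Delta$ infer $\Gamma\to\Delta$); left/right weakening and contraction; $\vee$-left (from $\Gamma,A\to\Delta$ and $\Gamma,B\to\Delta$ infer $\Gamma,A\vee B\to\Delta$); $\vee$-right (from $\Gamma\to\Delta,A,B$ infer $\Gamma\to\Delta,A\vee B$); positive decision left (from $\Gamma,A\to\Delta$ and $\Gamma,p,B\to\Delta$ infer $\Gamma,\mathrm{pd}(A,p,B)\to\Delta$) and right (from $\Gamma\to\Delta,A,p$ and $\Gamma\to\Delta,A,B$ infer $\Gamma\to\Delta,\mathrm{pd}(A,p,B)$).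 A proof is a finite list of sequents, each an axiom sequent from a set of positive extension axioms or following from earlier ones by a rule, all formulas positive, final sequent free of extension variables. -}

module Defs where

open import Data.Nat using (ℕ; _<_)
open import Data.Bool using (Bool; true; false; _∧_; _∨_; if_then_else_)
open import Data.List using (List; []; _∷_; length; lookup)
open import Data.List.Relation.Unary.All using (All)
open import Data.List.Relation.Unary.Any using (Any)
open import Data.List.Relation.Binary.Permutation.Propositional using (_↭_)
open import Data.Fin using (Fin; toℕ)
open import Data.Product using (Σ; _×_; _,_)
open import Data.Unit using (⊤)
open import Relation.Binary.PropositionalEquality using (_≡_)

-- Formulas of eNDT.  Propositional variables and extension variables are
-- both indexed by ℕ (pv p = p-th propositional variable, ev i = e_i).
data Form : Set where
  pv   : ℕ → Form
  ev   : ℕ → Form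
  𝟘 𝟙  : Form
  _∨ᶠ_ : Form → Form → Form
  dec  : Form → ℕ → Form → Form     -- dec A p B : if p then B else A

pd : Form → ℕ → Form → Form
pd A p C = dec A p (A ∨ᶠ C)

⟦_⟧ : Form → (ℕ → Bool) → (ℕ → Bool) → Bool
⟦ pv p ⟧ ρ σ = ρ p
⟦ ev i ⟧ ρ σ = σ i
⟦ 𝟘 ⟧ ρ σ = false
⟦ 𝟙 ⟧ ρ σ = true
⟦ A ∨ᶠ B ⟧ ρ σ = ⟦ A ⟧ ρ σ ∨ ⟦ B ⟧ ρ σ
⟦ dec A p B ⟧ ρ σ = if ρ p then ⟦ B ⟧ ρ σ else ⟦ A ⟧ ρ σ

data Positive : Form → Set where
  pos-pv  : ∀ p → Positive (pv p)
  pos-ev  : ∀ i → Positive (ev i)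
  pos-𝟘   : Positive 𝟘
  pos-𝟙   : Positive 𝟙
  pos-∨   : ∀ {A B} → Positive A → Positive B → Positive (A ∨ᶠ B)
  pos-pd  : ∀ {A C} p → Positive A → Positive C → Positive (pd A p C)

data ExtBelow (n : ℕ) : Form → Set where
  eb-pv  : ∀ p → ExtBelow n (pv p)
  eb-ev  : ∀ {i} → i < n → ExtBelow n (ev i)
  eb-𝟘   : ExtBelow n 𝟘
  eb-𝟙   : ExtBelow n 𝟙
  eb-∨   : ∀ {A B} → ExtBelow n A → ExtBelow n B → ExtBelow n (A ∨ᶠ B)
  eb-dec : ∀ {A B} p → ExtBelow n A → ExtBelow n B → ExtBelow n (dec A p B)

ExtFree : Form → Set
ExtFree = ExtBelow 0

-- Sequents Γ → Δ (cedents are lists; exchange is a structural rule below).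
record Sequent : Set where
  constructor _⇒_
  field
    ante : List Form
    succ : List Form
open Sequent public

PosSeq : Sequent → Set
PosSeq (Γ ⇒ Δ) = All Positive Γ × All Positive Δ

ExtFreeSeq : Sequent → Set
ExtFreeSeq (Γ ⇒ Δ) = All ExtFree Γ × All ExtFree Δ

-- Extension axioms {e_i ↔ A_i}_{i<n}: the list [A_0, …, A_{n-1}].
ExtAxioms : Set
ExtAxioms = List Form

PosExtAxioms : ExtAxioms → Set
PosExtAxioms E = (i : Fin (length E)) →
  Positive (lookup E i) × ExtBelow (toℕ i) (lookup E i)

-- Derivations in posELNDT from the extension axioms E (tree form of the
-- list-of-sequents proofs; the positivity of every sequent is imposed by
-- AllPos below).
infix 4 _⊢_
data _⊢_ (E : ExtAxioms) : Sequent → Set where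
  ax-ext₁ : (i : Fin (length E)) → E ⊢ (ev (toℕ i) ∷ []) ⇒ (lookup E i ∷ [])
  ax-ext₂ : (i : Fin (length E)) → E ⊢ (lookup E i ∷ []) ⇒ (ev (toℕ i) ∷ [])
  ax-0  : E ⊢ (𝟘 ∷ []) ⇒ []
  ax-1  : E ⊢ [] ⇒ (𝟙 ∷ [])
  ax-id : ∀ p → E ⊢ (pv p ∷ []) ⇒ (pv p ∷ [])
  exL : ∀ {Γ Γ' Δ} → Γ ↭ Γ' → E ⊢ Γ ⇒ Δ → E ⊢ Γ' ⇒ Δ
  exR : ∀ {Γ Δ Δ'} → Δ ↭ Δ' → E ⊢ Γ ⇒ Δ → E ⊢ Γ ⇒ Δ'
  cut : ∀ {Γ Δ} A → E ⊢ Γ ⇒ (A ∷ Δ) → E ⊢ (A ∷ Γ) ⇒ Δ → E ⊢ Γ ⇒ Δ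
  wL : ∀ {Γ Δ} A → E ⊢ Γ ⇒ Δ → E ⊢ (A ∷ Γ) ⇒ Δ
  wR : ∀ {Γ Δ} A → E ⊢ Γ ⇒ Δ → E ⊢ Γ ⇒ (A ∷ Δ)
  cL : ∀ {Γ Δ A} → E ⊢ (A ∷ A ∷ Γ) ⇒ Δ → E ⊢ (A ∷ Γ) ⇒ Δ
  cR : ∀ {Γ Δ A} → E ⊢ Γ ⇒ (A ∷ A ∷ Δ) → E ⊢ Γ ⇒ (A ∷ Δ)
  ∨L : ∀ {Γ Δ A B} → E ⊢ (A ∷ Γ) ⇒ Δ → E ⊢ (B ∷ Γ) ⇒ Δ
     → E ⊢ ((A ∨ᶠ B) ∷ Γ) ⇒ Δ
  ∨R : ∀ {Γ Δ A B} → E ⊢ Γ ⇒ (A ∷ B ∷ Δ) → E ⊢ Γ ⇒ ((A ∨ᶠ B) ∷ Δ)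
  pdL : ∀ {Γ Δ A B} p → E ⊢ (A ∷ Γ) ⇒ Δ → E ⊢ (pv p ∷ B ∷ Γ) ⇒ Δ
      → E ⊢ (pd A p B ∷ Γ) ⇒ Δ
  pdR : ∀ {Γ Δ A B} p → E ⊢ Γ ⇒ (A ∷ pv p ∷ Δ) → E ⊢ Γ ⇒ (A ∷ B ∷ Δ)
      → E ⊢ Γ ⇒ (pd A p B ∷ Δ)

OkSeq : ExtAxioms → Sequent → Set
OkSeq E (Γ ⇒ Δ) = PosSeq (Γ ⇒ Δ) × All (ExtBelow (length E)) Γ
                                  × All (ExtBelow (length E)) Δ

AllPos : ∀ {E s} → E ⊢ s → Set
AllPos {E} {s} (ax-ext₁ i) = OkSeq E s
AllPos {E} {s} (ax-ext₂ i) = OkSeq E s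
AllPos {E} {s} ax-0 = OkSeq E s
AllPos {E} {s} ax-1 = OkSeq E s
AllPos {E} {s} (ax-id p) = OkSeq E s
AllPos {E} {s} (exL _ d) = OkSeq E s × AllPos d
AllPos {E} {s} (exR _ d) = OkSeq E s × AllPos d
AllPos {E} {s} (cut _ d₁ d₂) = OkSeq E s × AllPos d₁ × AllPos d₂
AllPos {E} {s} (wL _ d) = OkSeq E s × AllPos d
AllPos {E} {s} (wR _ d) = OkSeq E s × AllPos d
AllPos {E} {s} (cL d) = OkSeq E s × AllPos d
AllPos {E} {s} (cR d) = OkSeq E s × AllPos d
AllPos {E} {s} (∨L d₁ d₂) = OkSeq E s × AllPos d₁ × AllPos d₂
AllPos {E} {s} (∨R d) = OkSeq E s × AllPos d
AllPos {E} {s} (pdL _ d₁ d₂) = OkSeq E s × AllPos d₁ × AllPos d₂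
AllPos {E} {s} (pdR _ d₁ d₂) = OkSeq E s × AllPos d₁ × AllPos d₂

Provable : Sequent → Set
Provable s = Σ ExtAxioms λ E → PosExtAxioms E × Σ (E ⊢ s) AllPos

-- Validity of ⋀Γ ⊃ ⋁Δ for a sequent without extension variables
-- (extension variables are interpreted arbitrarily, here as false; this is
-- irrelevant for extension-free sequents).
Valid : Sequent → Set
Valid (Γ ⇒ Δ) = (ρ : ℕ → Bool) →
  All (λ A → ⟦ A ⟧ ρ (λ _ → false) ≡ true) Γ →
  Any (λ A → ⟦ A ⟧ ρ (λ _ → false) ≡ true) Δ

-- Soundness: the extension axioms are acyclic, so iterating their definitions
-- n times from any start yields an interpretation σ of e_0, …, e_{n-1} that
-- satisfies all of them; every rule preserves truth under (ρ, σ), and σ is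
-- irrelevant for extension-free end sequents.
--
-- A valid sequent of
-- variables shares a variable on both sides: otherwise the assignment making
-- exactly the left-hand variables true refutes it.

module Submission where

open import Defs
open import Data.Bool using (Bool; true; false; _∨_; if_then_else_)
open import Data.Bool.Properties using (T-≡)
open import Data.Fin using (Fin; toℕ; fromℕ<)
open import Data.Fin.Properties using (toℕ<n; toℕ-fromℕ<; fromℕ<-toℕ)
open import Data.List using (List; []; _∷_; _++_; length; lookup)
open import Data.List.Properties using (++-assoc; ++-identityʳ)
open import Data.List.Membership.Propositional using (_∈_; find)
open import Data.List.Membership.Propositional.Properties using (∈-∃++)
open import Data.List.Relation.Unary.All as All using (All; []; _∷_)
open import Data.List.Relation.Unary.All.Properties using (++⁺)
open import Data.List.Relation.Unary.Any as Any using (Any; here; there)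
open import Data.List.Relation.Binary.Permutation.Propositional
  using (_↭_; ↭-sym; ↭-reflexive)
open import Data.List.Relation.Binary.Permutation.Propositional.Properties
  using (All-resp-↭; Any-resp-↭; shift; shifts; ++-comm)
open import Data.Nat using (ℕ; zero; suc; _<_; _<?_; _≟_; s≤s⁻¹)
open import Data.Nat.Properties using (<-≤-trans)
open import Data.Product as Product using (Σ; ∃; _×_; _,_; proj₁; proj₂)
open import Data.Sum as Sum using (_⊎_; inj₁; inj₂; [_,_]; [_,_]′)
open import Function using (id; const; _∘_)
open import Function.Bundles using (_⇔_; mk⇔; Equivalence)
open import Relation.Nullary using (Dec; yes; no; contradiction)
open import Relation.Nullary.Decidable using (isYes; map′; toWitness; fromWitness)
open import Relation.Binary.PropositionalEquality
  using (_≡_; refl; sym; trans; cong; cong₂; subst)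

open Equivalence using (to; from)

private
  variable
    A B C : Form
    Γ Γ′ Δ Δ′ Φ Ψ : List Form
    E : ExtAxioms
    ρ σ σ′ : ℕ → Bool

Holds : (ℕ → Bool) → (ℕ → Bool) → Form → Set
Holds ρ σ A = ⟦ A ⟧ ρ σ ≡ true

∨-≡true : ∀ a b → a ∨ b ≡ true ⇔ (a ≡ true ⊎ b ≡ true)
∨-≡true true  b = mk⇔ (const (inj₁ refl)) (const refl)
∨-≡true false b = mk⇔ inj₂ [ (λ ()) , id ]

if-∨-≡true : ∀ c a b →
  (if c then a ∨ b else a) ≡ true ⇔ (a ≡ true ⊎ (c ≡ true × b ≡ true))
if-∨-≡true true  a b = mk⇔ (Sum.map₂ (refl ,_) ∘ to (∨-≡true a b))
                           (from (∨-≡true a b) ∘ Sum.map₂ proj₂)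
if-∨-≡true false a b = mk⇔ inj₁ [ id , (λ ()) ∘ proj₁ ]

Holds-∨ : ∀ A B → Holds ρ σ (A ∨ᶠ B) ⇔ (Holds ρ σ A ⊎ Holds ρ σ B)
Holds-∨ {ρ} {σ} A B = ∨-≡true (⟦ A ⟧ ρ σ) (⟦ B ⟧ ρ σ)

Holds-pd : ∀ A p C →
  Holds ρ σ (pd A p C) ⇔ (Holds ρ σ A ⊎ (ρ p ≡ true × Holds ρ σ C))
Holds-pd {ρ} {σ} A p C = if-∨-≡true (ρ p) (⟦ A ⟧ ρ σ) (⟦ C ⟧ ρ σ)

⟦⟧-cong-below : ∀ {m} → ExtBelow m A →
  (∀ {j} → j < m → σ j ≡ σ′ j) → ⟦ A ⟧ ρ σ ≡ ⟦ A ⟧ ρ σ′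
⟦⟧-cong-below (eb-pv p)       σ≗σ′ = refl
⟦⟧-cong-below (eb-ev i<m)     σ≗σ′ = σ≗σ′ i<m
⟦⟧-cong-below eb-𝟘            σ≗σ′ = refl
⟦⟧-cong-below eb-𝟙            σ≗σ′ = refl
⟦⟧-cong-below (eb-∨ a b)      σ≗σ′ =
  cong₂ _∨_ (⟦⟧-cong-below a σ≗σ′) (⟦⟧-cong-below b σ≗σ′)
⟦⟧-cong-below {ρ = ρ} (eb-dec p a b) σ≗σ′ with ρ p
... | true  = ⟦⟧-cong-below b σ≗σ′
... | false = ⟦⟧-cong-below a σ≗σ′

Holds-extFree : ExtFree A → Holds ρ σ A → Holds ρ σ′ A
Holds-extFree e = trans (sym (⟦⟧-cong-below e λ ()))

Models : ExtAxioms → (ℕ → Bool) → (ℕ → Bool) → Set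
Models E ρ σ = (i : Fin (length E)) → σ (toℕ i) ≡ ⟦ lookup E i ⟧ ρ σ

-- 𝟘 beyond the axioms, which keeps every index trivially acyclic.
definiens : ExtAxioms → ℕ → Form
definiens E j with j <? length E
... | yes j<n = lookup E (fromℕ< j<n)
... | no  _   = 𝟘

definiens-lookup : ∀ E (i : Fin (length E)) → definiens E (toℕ i) ≡ lookup E i
definiens-lookup E i with toℕ i <? length E
... | yes i<n = cong (lookup E) (fromℕ<-toℕ i i<n)
... | no  i≮n = contradiction (toℕ<n i) i≮n

definiens-acyclic : ∀ E → PosExtAxioms E → ∀ j → ExtBelow j (definiens E j)
definiens-acyclic E wf j with j <? length E
... | yes j<n = subst (λ k → ExtBelow k (lookup E (fromℕ< j<n)))
                      (toℕ-fromℕ< j<n) (proj₂ (wf (fromℕ< j<n)))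
... | no  _   = eb-𝟘

iterate : ExtAxioms → (ℕ → Bool) → ℕ → ℕ → Bool
iterate E ρ zero    = const false
iterate E ρ (suc k) = λ j → ⟦ definiens E j ⟧ ρ (iterate E ρ k)

iterate-stable : (∀ j → ExtBelow j (definiens E j)) →
  ∀ k {j} → j < k → iterate E ρ k j ≡ iterate E ρ (suc k) j
iterate-stable acyclic (suc k) {j} j<1+k =
  ⟦⟧-cong-below (acyclic j)
    (λ i<j → iterate-stable acyclic k (<-≤-trans i<j (s≤s⁻¹ j<1+k)))

model : ∀ E → PosExtAxioms E → ∀ ρ → ∃ (Models E ρ)
model E wf ρ = fixpoint , fixpoint⊨E
  where
  fixpoint : ℕ → Bool
  fixpoint = iterate E ρ (length E)
  fixpoint⊨E : Models E ρ fixpoint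
  fixpoint⊨E i =
    trans (iterate-stable {E} (definiens-acyclic E wf) (length E) (toℕ<n i))
          (cong (λ A → ⟦ A ⟧ ρ fixpoint) (definiens-lookup E i))

module _ (σ⊨E : Models E ρ σ) where

  sound : E ⊢ Γ ⇒ Δ → All (Holds ρ σ) Γ → Any (Holds ρ σ) Δ
  sound (ax-ext₁ i) (h ∷ []) = here (trans (sym (σ⊨E i)) h)
  sound (ax-ext₂ i) (h ∷ []) = here (trans (σ⊨E i) h)
  sound ax-0        (() ∷ [])
  sound ax-1        []       = here refl
  sound (ax-id p)   (h ∷ []) = here h
  sound (exL π d)   hs       = sound d (All-resp-↭ (↭-sym π) hs)
  sound (exR π d)   hs       = Any-resp-↭ π (sound d hs)
  sound (cut A d₁ d₂) hs with sound d₁ hs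
  ... | here  h = sound d₂ (h ∷ hs)
  ... | there r = r
  sound (wL A d)    (_ ∷ hs) = sound d hs
  sound (wR A d)    hs       = there (sound d hs)
  sound (cL d)      (h ∷ hs) = sound d (h ∷ h ∷ hs)
  sound (cR d)      hs with sound d hs
  ... | here h          = here h
  ... | there (here h)  = here h
  ... | there (there r) = there r
  sound (∨L {A = A} {B} d₁ d₂) (h ∷ hs) =
    [ (λ a → sound d₁ (a ∷ hs)) , (λ b → sound d₂ (b ∷ hs)) ] (to (Holds-∨ A B) h)
  sound (∨R {A = A} {B} d) hs with sound d hs
  ... | here a          = here (from (Holds-∨ A B) (inj₁ a))
  ... | there (here b)  = here (from (Holds-∨ A B) (inj₂ b))
  ... | there (there r) = there r
  sound (pdL {A = A} {C} p d₁ d₂) (h ∷ hs) =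
    [ (λ a → sound d₁ (a ∷ hs)) , (λ (hp , c) → sound d₂ (hp ∷ c ∷ hs)) ]
      (to (Holds-pd A p C) h)
  sound (pdR {A = A} {C} p d₁ d₂) hs with sound d₁ hs | sound d₂ hs
  ... | there (there r) | _               = there r
  ... | _               | there (there r) = there r
  ... | here a          | _               = here (from (Holds-pd A p C) (inj₁ a))
  ... | there (here _)  | here a          = here (from (Holds-pd A p C) (inj₁ a))
  ... | there (here hp) | there (here c)  = here (from (Holds-pd A p C) (inj₂ (hp , c)))

soundness : ∀ {s} → ExtFreeSeq s → Provable s → Valid s
soundness (eΓ , eΔ) (E , wf , d , _) ρ hΓ =
  back eΔ (sound (proj₂ (model E wf ρ)) d
                 (All.zipWith (λ (e , h) → Holds-extFree e h) (eΓ , hΓ)))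
  where
  back : All ExtFree Δ → Any (Holds ρ σ) Δ → Any (Holds ρ σ′) Δ
  back (e ∷ _)  (here h)  = here (Holds-extFree e h)
  back (_ ∷ es) (there r) = there (back es r)

data PosExtFree : Form → Set where
  pv⁺  : ∀ p → PosExtFree (pv p)
  𝟘⁺   : PosExtFree 𝟘
  𝟙⁺   : PosExtFree 𝟙
  _∨⁺_ : PosExtFree A → PosExtFree B → PosExtFree (A ∨ᶠ B)
  pd⁺  : ∀ p → PosExtFree A → PosExtFree C → PosExtFree (pd A p C)

posExtFree : Positive A → ExtFree A → PosExtFree A
posExtFree (pos-pv p)     _                         = pv⁺ p
posExtFree (pos-ev i)     (eb-ev ())
posExtFree pos-𝟘          _                         = 𝟘⁺
posExtFree pos-𝟙          _                         = 𝟙⁺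
posExtFree (pos-∨ a b)    (eb-∨ a′ b′)              = posExtFree a a′ ∨⁺ posExtFree b b′
posExtFree (pos-pd p a c) (eb-dec _ a′ (eb-∨ _ c′)) = pd⁺ p (posExtFree a a′) (posExtFree c c′)

PosExtFree⇒Positive : PosExtFree A → Positive A
PosExtFree⇒Positive (pv⁺ p)      = pos-pv p
PosExtFree⇒Positive 𝟘⁺           = pos-𝟘
PosExtFree⇒Positive 𝟙⁺           = pos-𝟙
PosExtFree⇒Positive (a ∨⁺ b)     = pos-∨ (PosExtFree⇒Positive a) (PosExtFree⇒Positive b)
PosExtFree⇒Positive (pd⁺ p a c)  = pos-pd p (PosExtFree⇒Positive a) (PosExtFree⇒Positive c)

PosExtFree⇒ExtFree : PosExtFree A → ExtFree A
PosExtFree⇒ExtFree (pv⁺ p)     = eb-pv p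
PosExtFree⇒ExtFree 𝟘⁺          = eb-𝟘
PosExtFree⇒ExtFree 𝟙⁺          = eb-𝟙
PosExtFree⇒ExtFree (a ∨⁺ b)    = eb-∨ (PosExtFree⇒ExtFree a) (PosExtFree⇒ExtFree b)
PosExtFree⇒ExtFree (pd⁺ p a c) =
  eb-dec p (PosExtFree⇒ExtFree a) (eb-∨ (PosExtFree⇒ExtFree a) (PosExtFree⇒ExtFree c))

okSeq : All PosExtFree Γ → All PosExtFree Δ → OkSeq [] (Γ ⇒ Δ)
okSeq gΓ gΔ = (All.map PosExtFree⇒Positive gΓ , All.map PosExtFree⇒Positive gΔ)
            , All.map PosExtFree⇒ExtFree gΓ , All.map PosExtFree⇒ExtFree gΔ

-- Well-formedness is demanded of the conclusion only: every rule below passes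
-- it up to its premises, whose formulas are subformulas of the conclusion's.
Derivable : List Form → List Form → Set
Derivable Γ Δ = All PosExtFree Γ → All PosExtFree Δ → Σ ([] ⊢ Γ ⇒ Δ) AllPos

ax-0ᵈ : Derivable (𝟘 ∷ []) []
ax-0ᵈ gΓ gΔ = ax-0 , okSeq gΓ gΔ

ax-1ᵈ : Derivable [] (𝟙 ∷ [])
ax-1ᵈ gΓ gΔ = ax-1 , okSeq gΓ gΔ

ax-idᵈ : ∀ p → Derivable (pv p ∷ []) (pv p ∷ [])
ax-idᵈ p gΓ gΔ = ax-id p , okSeq gΓ gΔ

exLᵈ : Γ ↭ Γ′ → Derivable Γ Δ → Derivable Γ′ Δ
exLᵈ π d gΓ′ gΔ =
  Product.map (exL π) (okSeq gΓ′ gΔ ,_) (d (All-resp-↭ (↭-sym π) gΓ′) gΔ)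

exRᵈ : Δ ↭ Δ′ → Derivable Γ Δ → Derivable Γ Δ′
exRᵈ π d gΓ gΔ′ =
  Product.map (exR π) (okSeq gΓ gΔ′ ,_) (d gΓ (All-resp-↭ (↭-sym π) gΔ′))

wLᵈ : Derivable Γ Δ → Derivable (A ∷ Γ) Δ
wLᵈ d gAΓ@(_ ∷ gΓ) gΔ = Product.map (wL _) (okSeq gAΓ gΔ ,_) (d gΓ gΔ)

wRᵈ : Derivable Γ Δ → Derivable Γ (A ∷ Δ)
wRᵈ d gΓ gAΔ@(_ ∷ gΔ) = Product.map (wR _) (okSeq gΓ gAΔ ,_) (d gΓ gΔ)

∨Lᵈ : Derivable (A ∷ Γ) Δ → Derivable (B ∷ Γ) Δ → Derivable (A ∨ᶠ B ∷ Γ) Δ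
∨Lᵈ d₁ d₂ gΓ@((gA ∨⁺ gB) ∷ gs) gΔ =
  let e₁ , a₁ = d₁ (gA ∷ gs) gΔ
      e₂ , a₂ = d₂ (gB ∷ gs) gΔ
  in ∨L e₁ e₂ , okSeq gΓ gΔ , a₁ , a₂

∨Rᵈ : Derivable Γ (A ∷ B ∷ Δ) → Derivable Γ (A ∨ᶠ B ∷ Δ)
∨Rᵈ d gΓ gΔ@((gA ∨⁺ gB) ∷ gs) =
  Product.map ∨R (okSeq gΓ gΔ ,_) (d gΓ (gA ∷ gB ∷ gs))

pdLᵈ : ∀ p → Derivable (A ∷ Γ) Δ → Derivable (pv p ∷ C ∷ Γ) Δ →
       Derivable (pd A p C ∷ Γ) Δ
pdLᵈ p d₁ d₂ gΓ@(pd⁺ _ gA gC ∷ gs) gΔ =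
  let e₁ , a₁ = d₁ (gA ∷ gs) gΔ
      e₂ , a₂ = d₂ (pv⁺ p ∷ gC ∷ gs) gΔ
  in pdL p e₁ e₂ , okSeq gΓ gΔ , a₁ , a₂

pdRᵈ : ∀ p → Derivable Γ (A ∷ pv p ∷ Δ) → Derivable Γ (A ∷ C ∷ Δ) →
       Derivable Γ (pd A p C ∷ Δ)
pdRᵈ p d₁ d₂ gΓ gΔ@(pd⁺ _ gA gC ∷ gs) =
  let e₁ , a₁ = d₁ gΓ (gA ∷ pv⁺ p ∷ gs)
      e₂ , a₂ = d₂ gΓ (gA ∷ gC ∷ gs)
  in pdR p e₁ e₂ , okSeq gΓ gΔ , a₁ , a₂

weakenLᵈ : ∀ Θ → Derivable Γ Δ → Derivable (Γ ++ Θ) Δ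
weakenLᵈ {Γ} {Δ} Θ d = exLᵈ (++-comm Θ Γ) (prepend Θ)
  where
  prepend : ∀ Θ → Derivable (Θ ++ Γ) Δ
  prepend []      = d
  prepend (_ ∷ Θ) = wLᵈ (prepend Θ)

weakenRᵈ : ∀ Θ → Derivable Γ Δ → Derivable Γ (Δ ++ Θ)
weakenRᵈ {Γ} {Δ} Θ d = exRᵈ (++-comm Θ Δ) (prepend Θ)
  where
  prepend : ∀ Θ → Derivable Γ (Θ ++ Δ)
  prepend []      = d
  prepend (_ ∷ Θ) = wRᵈ (prepend Θ)

Sat : (ℕ → Bool) → Form → Set
Sat ρ = Holds ρ (const false)

Valid-mapˡ : (∀ {ρ} → All (Sat ρ) Γ′ → All (Sat ρ) Γ) →
             Valid (Γ ⇒ Δ) → Valid (Γ′ ⇒ Δ)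
Valid-mapˡ f v ρ = v ρ ∘ f

Valid-mapʳ : (∀ {ρ} → Any (Sat ρ) Δ → Any (Sat ρ) Δ′) →
             Valid (Γ ⇒ Δ) → Valid (Γ ⇒ Δ′)
Valid-mapʳ f v ρ = f ∘ v ρ

Valid-↭ˡ : Γ ↭ Γ′ → Valid (Γ ⇒ Δ) → Valid (Γ′ ⇒ Δ)
Valid-↭ˡ π = Valid-mapˡ (All-resp-↭ (↭-sym π))

Valid-↭ʳ : Δ ↭ Δ′ → Valid (Γ ⇒ Δ) → Valid (Γ ⇒ Δ′)
Valid-↭ʳ π = Valid-mapʳ (Any-resp-↭ π)

data IsVar : Form → Set where
  var : ∀ p → IsVar (pv p)

pv≟ : ∀ q A → Dec (pv q ≡ A)
pv≟ q (pv p)      = map′ (cong pv) (λ { refl → refl }) (q ≟ p)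
pv≟ q (ev i)      = no λ ()
pv≟ q 𝟘           = no λ ()
pv≟ q 𝟙           = no λ ()
pv≟ q (A ∨ᶠ B)    = no λ ()
pv≟ q (dec A p B) = no λ ()

axiom-∈ : ∀ {q} → pv q ∈ Γ → pv q ∈ Δ → Derivable Γ Δ
axiom-∈ {q = q} q∈Γ q∈Δ
  with Γ₁ , Γ₂ , refl ← ∈-∃++ q∈Γ
     | Δ₁ , Δ₂ , refl ← ∈-∃++ q∈Δ
  = exLᵈ (↭-sym (shift (pv q) Γ₁ Γ₂)) (exRᵈ (↭-sym (shift (pv q) Δ₁ Δ₂))
      (weakenRᵈ (Δ₁ ++ Δ₂) (weakenLᵈ (Γ₁ ++ Γ₂) (ax-idᵈ q))))

variables-complete : All IsVar Γ → All IsVar Δ → Valid (Γ ⇒ Δ) → Derivable Γ Δ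
variables-complete {Γ} {Δ} varsΓ varsΔ v =
  let A , A∈Δ , hA = find (v ρΓ (All.tabulate (λ A∈Γ → holds (All.lookup varsΓ A∈Γ) A∈Γ)))
  in shared (All.lookup varsΔ A∈Δ) A∈Δ hA
  where
  ρΓ : ℕ → Bool
  ρΓ q = isYes (Any.any? (pv≟ q) Γ)
  holds : IsVar A → A ∈ Γ → Sat ρΓ A
  holds (var q) = to T-≡ ∘ fromWitness
  shared : IsVar A → A ∈ Δ → Sat ρΓ A → Derivable Γ Δ
  shared (var q) q∈Δ hq = axiom-∈ (toWitness (from T-≡ hq)) q∈Δ

-- Φ, in front of any Δ, reduces by invertible rules to lists Θ of variables:
-- it suffices to derive the valid sequents with Θ in place of Φ.
Decomposableʳ : List Form → List Form → Set
Decomposableʳ Γ Φ = ∀ Δ →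
  (∀ Θ → All IsVar Θ → Valid (Γ ⇒ (Θ ++ Δ)) → Derivable Γ (Θ ++ Δ)) →
  Valid (Γ ⇒ (Φ ++ Δ)) → Derivable Γ (Φ ++ Δ)

varsʳ : All IsVar Φ → Decomposableʳ Γ Φ
varsʳ varsΦ Δ k = k _ varsΦ

infixr 5 _∷ʳ_ _∷ˡ_

_∷ʳ_ : Decomposableʳ Γ (A ∷ []) → Decomposableʳ Γ Ψ → Decomposableʳ Γ (A ∷ Ψ)
_∷ʳ_ {Γ} {Ψ = Ψ} dA dΨ Δ k = dA (Ψ ++ Δ) kA
  where
  kA : ∀ Θ → All IsVar Θ → Valid (Γ ⇒ (Θ ++ Ψ ++ Δ)) → Derivable Γ (Θ ++ Ψ ++ Δ)
  kA Θ varsΘ = exRᵈ (shifts Ψ Θ) ∘ dΨ (Θ ++ Δ) kΨ ∘ Valid-↭ʳ (shifts Θ Ψ)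
    where
    kΨ : ∀ Θ′ → All IsVar Θ′ → Valid (Γ ⇒ (Θ′ ++ Θ ++ Δ)) → Derivable Γ (Θ′ ++ Θ ++ Δ)
    kΨ Θ′ varsΘ′ = exRᵈ assoc ∘ k (Θ′ ++ Θ) (++⁺ varsΘ′ varsΘ) ∘ Valid-↭ʳ (↭-sym assoc)
      where
      assoc : (Θ′ ++ Θ) ++ Δ ↭ Θ′ ++ Θ ++ Δ
      assoc = ↭-reflexive (++-assoc Θ′ Θ Δ)

decomposeʳ : PosExtFree A → Decomposableʳ Γ (A ∷ [])
decomposeʳ (pv⁺ p) = varsʳ (var p ∷ [])
decomposeʳ 𝟘⁺ Δ k = wRᵈ ∘ k [] [] ∘ Valid-mapʳ λ { (here ()) ; (there h) → h }
decomposeʳ {Γ = Γ} 𝟙⁺ Δ k _ = weakenLᵈ Γ (weakenRᵈ Δ ax-1ᵈ)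
decomposeʳ (_∨⁺_ {A} {B} gA gB) Δ k =
  ∨Rᵈ ∘ (decomposeʳ gA ∷ʳ decomposeʳ gB) Δ k ∘ Valid-mapʳ invert
  where
  invert : ∀ {ρ} → Any (Sat ρ) (A ∨ᶠ B ∷ Δ) → Any (Sat ρ) (A ∷ B ∷ Δ)
  invert (here h)  = [ here , there ∘ here ]′ (to (Holds-∨ A B) h)
  invert (there h) = there (there h)
decomposeʳ (pd⁺ {A} {C} p gA gC) Δ k v =
  pdRᵈ p ((decomposeʳ gA ∷ʳ varsʳ (var p ∷ [])) Δ k (Valid-mapʳ invert₁ v))
         ((decomposeʳ gA ∷ʳ decomposeʳ gC) Δ k (Valid-mapʳ invert₂ v))
  where
  invert₁ : ∀ {ρ} → Any (Sat ρ) (pd A p C ∷ Δ) → Any (Sat ρ) (A ∷ pv p ∷ Δ)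
  invert₁ (here h)  = [ here , there ∘ here ∘ proj₁ ]′ (to (Holds-pd A p C) h)
  invert₁ (there h) = there (there h)
  invert₂ : ∀ {ρ} → Any (Sat ρ) (pd A p C ∷ Δ) → Any (Sat ρ) (A ∷ C ∷ Δ)
  invert₂ (here h)  = [ here , there ∘ here ∘ proj₂ ]′ (to (Holds-pd A p C) h)
  invert₂ (there h) = there (there h)

decomposeAllʳ : All PosExtFree Φ → Decomposableʳ Γ Φ
decomposeAllʳ []       = varsʳ []
decomposeAllʳ (g ∷ gs) = decomposeʳ g ∷ʳ decomposeAllʳ gs

Decomposableˡ : List Form → List Form → Set
Decomposableˡ Δ Φ = ∀ Γ →
  (∀ Θ → All IsVar Θ → Valid ((Θ ++ Γ) ⇒ Δ) → Derivable (Θ ++ Γ) Δ) →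
  Valid ((Φ ++ Γ) ⇒ Δ) → Derivable (Φ ++ Γ) Δ

varsˡ : All IsVar Φ → Decomposableˡ Δ Φ
varsˡ varsΦ Γ k = k _ varsΦ

_∷ˡ_ : Decomposableˡ Δ (A ∷ []) → Decomposableˡ Δ Ψ → Decomposableˡ Δ (A ∷ Ψ)
_∷ˡ_ {Δ} {Ψ = Ψ} dA dΨ Γ k = dA (Ψ ++ Γ) kA
  where
  kA : ∀ Θ → All IsVar Θ → Valid ((Θ ++ Ψ ++ Γ) ⇒ Δ) → Derivable (Θ ++ Ψ ++ Γ) Δ
  kA Θ varsΘ = exLᵈ (shifts Ψ Θ) ∘ dΨ (Θ ++ Γ) kΨ ∘ Valid-↭ˡ (shifts Θ Ψ)
    where
    kΨ : ∀ Θ′ → All IsVar Θ′ → Valid ((Θ′ ++ Θ ++ Γ) ⇒ Δ) → Derivable (Θ′ ++ Θ ++ Γ) Δ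
    kΨ Θ′ varsΘ′ = exLᵈ assoc ∘ k (Θ′ ++ Θ) (++⁺ varsΘ′ varsΘ) ∘ Valid-↭ˡ (↭-sym assoc)
      where
      assoc : (Θ′ ++ Θ) ++ Γ ↭ Θ′ ++ Θ ++ Γ
      assoc = ↭-reflexive (++-assoc Θ′ Θ Γ)

decomposeˡ : PosExtFree A → Decomposableˡ Δ (A ∷ [])
decomposeˡ (pv⁺ p) = varsˡ (var p ∷ [])
decomposeˡ {Δ = Δ} 𝟘⁺ Γ k _ = weakenRᵈ Δ (weakenLᵈ Γ ax-0ᵈ)
decomposeˡ 𝟙⁺ Γ k = wLᵈ ∘ k [] [] ∘ Valid-mapˡ (refl ∷_)
decomposeˡ (_∨⁺_ {A} {B} gA gB) Γ k v =
  ∨Lᵈ (decomposeˡ gA Γ k (Valid-mapˡ (λ { (h ∷ hs) → from (Holds-∨ A B) (inj₁ h) ∷ hs }) v))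
      (decomposeˡ gB Γ k (Valid-mapˡ (λ { (h ∷ hs) → from (Holds-∨ A B) (inj₂ h) ∷ hs }) v))
decomposeˡ (pd⁺ {A} {C} p gA gC) Γ k v =
  pdLᵈ p (decomposeˡ gA Γ k (Valid-mapˡ (λ { (h ∷ hs) → from (Holds-pd A p C) (inj₁ h) ∷ hs }) v))
         ((varsˡ (var p ∷ []) ∷ˡ decomposeˡ gC) Γ k
            (Valid-mapˡ (λ { (hp ∷ h ∷ hs) → from (Holds-pd A p C) (inj₂ (hp , h)) ∷ hs }) v))

decomposeAllˡ : All PosExtFree Φ → Decomposableˡ Δ Φ
decomposeAllˡ []       = varsˡ []
decomposeAllˡ (g ∷ gs) = decomposeˡ g ∷ˡ decomposeAllˡ gs

complete : All PosExtFree Γ → All PosExtFree Δ → Valid (Γ ⇒ Δ) → Derivable Γ Δ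
complete {Γ} {Δ} gΓ gΔ =
  exLᵈ (idʳ Γ) ∘ decomposeAllˡ gΓ [] leftVars ∘ Valid-↭ˡ (↭-sym (idʳ Γ))
  where
  idʳ : ∀ Φ → Φ ++ [] ↭ Φ
  idʳ Φ = ↭-reflexive (++-identityʳ Φ)
  leftVars : ∀ Θ → All IsVar Θ → Valid ((Θ ++ []) ⇒ Δ) → Derivable (Θ ++ []) Δ
  leftVars Θ varsΘ =
    exRᵈ (idʳ Δ) ∘ decomposeAllʳ gΔ []
      (λ Θ′ varsΘ′ → variables-complete (++⁺ varsΘ []) (++⁺ varsΘ′ []))
    ∘ Valid-↭ʳ (↭-sym (idʳ Δ))

mainTheorem6 : (s : Sequent) → PosSeq s → ExtFreeSeq s → (Provable s ⇔ Valid s)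
mainTheorem6 (Γ ⇒ Δ) (pΓ , pΔ) (eΓ , eΔ) = mk⇔ (soundness (eΓ , eΔ)) completeness
  where
  gΓ : All PosExtFree Γ
  gΓ = All.zipWith (Product.uncurry posExtFree) (pΓ , eΓ)
  gΔ : All PosExtFree Δ
  gΔ = All.zipWith (Product.uncurry posExtFree) (pΔ , eΔ)
  completeness : Valid (Γ ⇒ Δ) → Provable (Γ ⇒ Δ)
  completeness v = [] , (λ ()) , complete gΓ gΔ v gΓ gΔ
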